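{- Let $k\ge1$ be an integer and let $\{U_n(k)\}_{n\ge0}$ be defined by $U_0(k)=0$, $U_1(k)=1$, $U_{n+2}(k)=(4k+2)U_{n+1}(k)-U_n(k)$. Let $a\ge0$ and $i,j\ge0$ be integers. If $U_i(k)\equiv U_j(k)\pmod{2^a}$, then $i\equiv j\pmod{2^a}$. -}

module Defs where

open import Data.Nat using (ℕ; zero; suc)
open import Data.Integer using (ℤ; +_; _+_; _-_; _*_)
open import Data.Integer.Divisibility using (_∣_)

U : ℕ → ℕ → ℤ
U k zero = + 0
U k (suc zero) = + 1
U k (suc (suc n)) = (+ 4 * + k + + 2) * U k (suc n) - U k n

infix 4 _≡_[mod_]
_≡_[mod_] : ℤ → ℤ → ℤ → Set
x ≡ y [mod m ] = m ∣ (x - y)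

module Submission where

-- Let u = U k, so u₀ = 0, u₁ = 1 and u (n+2) = c·u (n+1) − u n with
-- c = 4k+2.  We show, by induction on a, that 2^a ∣ u (j+d) − u j forces
-- 2^a ∣ d (this implies the theorem after ordering i and j).
--
-- General facts come first.  (1) Divisibility by powers of two: doubling
-- and halving, and cancellation of an odd factor (via Euclid's lemma for
-- the prime 2).  (2) Sequences satisfying f (n+2) = c·f (n+1) − f n for an
-- arbitrary c: they are determined by f 0 and f 1, and are closed under
-- shifts, differences and scalar multiples.  (3) For the solution u with
-- u 0 = 0, u 1 = 1 this yields the addition formula, Cassini's identity and
-- the key identity  u (j+2s) − u j = u s · V (j+s),  V n = 2u (n+1) − c·u n.
--
-- For c = 4k+2 we then have u n ≡ n (mod 2) and V n = 2·W n with W n odd.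
-- In the inductive step, 2 ∣ u (j+d) − u j gives 2 ∣ d, say d = 2s; the key
-- identity turns 2^(a+1) ∣ u (j+2s) − u j into 2^a ∣ u s · W (j+s), hence
-- 2^a ∣ u s = u (0+s) − u 0, and the induction hypothesis gives 2^a ∣ s.

open import Defs
open import Data.Nat using (ℕ; _≥_; _^_)
open import Data.Integer using (+_)

import Data.Nat as ℕ
import Data.Nat.Properties as ℕₚ
import Data.Nat.Divisibility as ℕ∣
open import Data.Nat.Primality using (euclidsLemma; prime[2])
open import Data.Integer using (ℤ; ∣_∣; _+_; _-_; _*_; -_)
import Data.Integer.Properties as ℤₚ
open import Data.Integer.Divisibility.Signed
  using (_∣_; divides; ∣ᵤ⇒∣; ∣⇒∣ᵤ; ∣-refl; ∣-trans; ∣m⇒∣-m; ∣m∣n⇒∣m+n; ∣m∣n⇒∣m-n;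
         ∣n⇒∣m*n; ∣m⇒∣m*n; *-monoʳ-∣; *-cancelˡ-∣)
open import Data.Integer.Tactic.RingSolver using (solve-∀)
open import Data.Product using (∃; _,_)
open import Data.Sum using (_⊎_; inj₁; inj₂)
open import Data.Empty using (⊥-elim)
open import Relation.Nullary using (¬_)
open import Relation.Binary.PropositionalEquality
  using (_≡_; refl; sym; trans; cong; cong₂; subst; module ≡-Reasoning)

pow2-suc : ∀ a → + (2 ^ ℕ.suc a) ≡ + 2 * + (2 ^ a)
pow2-suc a = ℤₚ.pos-* 2 (2 ^ a)

double : ∀ a {x} → + (2 ^ a) ∣ x → + (2 ^ ℕ.suc a) ∣ + 2 * x
double a h = subst (_∣ _) (sym (pow2-suc a)) (*-monoʳ-∣ (+ 2) h)

halve : ∀ a {x} → + (2 ^ ℕ.suc a) ∣ + 2 * x → + (2 ^ a) ∣ x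
halve a h = *-cancelˡ-∣ (+ 2) (subst (_∣ _) (pow2-suc a) h)

two∣pow2-suc : ∀ a → + 2 ∣ + (2 ^ ℕ.suc a)
two∣pow2-suc a = divides (+ (2 ^ a)) (trans (pow2-suc a) (ℤₚ.*-comm (+ 2) (+ (2 ^ a))))

∣-swap : ∀ {m x y} → m ∣ x - y → m ∣ y - x
∣-swap {m} {x} {y} h = subst (m ∣_) (negate-difference x y) (∣m⇒∣-m h)
  where
  negate-difference : ∀ (x y : ℤ) → - (x - y) ≡ y - x
  negate-difference = solve-∀

odd⇒¬even : ∀ {x} → + 2 ∣ x - + 1 → ¬ (+ 2 ∣ x)
odd⇒¬even {x} odd even = two≢one (ℕ∣.∣1⇒≡1 (∣⇒∣ᵤ two∣one))
  where
  two≢one : ¬ (2 ≡ 1)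
  two≢one ()
  x-[x-1] : ∀ (x : ℤ) → x - (x - + 1) ≡ + 1
  x-[x-1] = solve-∀
  two∣one : + 2 ∣ + 1
  two∣one = subst (+ 2 ∣_) (x-[x-1] x) (∣m∣n⇒∣m-n even odd)

two∣*⇒two∣ : ∀ x y → + 2 ∣ x * y → (+ 2 ∣ x) ⊎ (+ 2 ∣ y)
two∣*⇒two∣ x y h
  with euclidsLemma (∣ x ∣) (∣ y ∣) prime[2] (subst (2 ℕ∣.∣_) (ℤₚ.abs-* x y) (∣⇒∣ᵤ h))
... | inj₁ 2∣x = inj₁ (∣ᵤ⇒∣ 2∣x)
... | inj₂ 2∣y = inj₂ (∣ᵤ⇒∣ 2∣y)

even⇒double : ∀ {d} → + 2 ∣ + d → ∃ λ s → d ≡ s ℕ.+ s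
even⇒double 2∣d with ∣⇒∣ᵤ 2∣d
... | ℕ∣.divides s d≡s*2 =
  s , trans d≡s*2 (trans (ℕₚ.*-comm s 2) (cong (s ℕ.+_) (ℕₚ.+-identityʳ s)))

cancel-odd : ∀ a {x y} → + 2 ∣ y - + 1 → + (2 ^ a) ∣ x * y → + (2 ^ a) ∣ x
cancel-odd ℕ.zero {x} _ _ = divides x (sym (ℤₚ.*-identityʳ x))
cancel-odd (ℕ.suc a) {x} {y} odd h
  with two∣*⇒two∣ x y (∣-trans (two∣pow2-suc a) h)
... | inj₂ even = ⊥-elim (odd⇒¬even odd even)
... | inj₁ (divides q x≡q*2) =
  subst (_ ∣_) 2q≡x (double a (cancel-odd a odd (halve a (subst (_ ∣_) xy≡2qy h))))
  where
  reassociate : ∀ (q y : ℤ) → q * + 2 * y ≡ + 2 * (q * y)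
  reassociate = solve-∀
  xy≡2qy : x * y ≡ + 2 * (q * y)
  xy≡2qy = trans (cong (_* y) x≡q*2) (reassociate q y)
  2q≡x : + 2 * q ≡ x
  2q≡x = trans (ℤₚ.*-comm (+ 2) q) (sym x≡q*2)

module Recurrence (c : ℤ) where

  Rec : (ℕ → ℤ) → Set
  Rec f = ∀ n → f (ℕ.suc (ℕ.suc n)) ≡ c * f (ℕ.suc n) - f n

  unique : ∀ {f g} → Rec f → Rec g → f 0 ≡ g 0 → f 1 ≡ g 1 → ∀ n → f n ≡ g n
  unique rf rg e₀ e₁ ℕ.zero = e₀
  unique rf rg e₀ e₁ (ℕ.suc ℕ.zero) = e₁
  unique {f} {g} rf rg e₀ e₁ (ℕ.suc (ℕ.suc n)) = begin
    f (ℕ.suc (ℕ.suc n))         ≡⟨ rf n ⟩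
    c * f (ℕ.suc n) - f n       ≡⟨ cong₂ (λ x y → c * x - y) (unique rf rg e₀ e₁ (ℕ.suc n))
                                                              (unique rf rg e₀ e₁ n) ⟩
    c * g (ℕ.suc n) - g n       ≡⟨ sym (rg n) ⟩
    g (ℕ.suc (ℕ.suc n))         ∎
    where open ≡-Reasoning

  rec-suc : ∀ {f} → Rec f → Rec (λ n → f (ℕ.suc n))
  rec-suc rf n = rf (ℕ.suc n)

  rec-shift : ∀ {f} m → Rec f → Rec (λ n → f (n ℕ.+ m))
  rec-shift m rf n = rf (n ℕ.+ m)

  rec-sub : ∀ {f g} → Rec f → Rec g → Rec (λ n → f n - g n)
  rec-sub {f} {g} rf rg n = begin
    f (ℕ.suc (ℕ.suc n)) - g (ℕ.suc (ℕ.suc n))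
      ≡⟨ cong₂ _-_ (rf n) (rg n) ⟩
    (c * f (ℕ.suc n) - f n) - (c * g (ℕ.suc n) - g n)
      ≡⟨ linear c (f n) (f (ℕ.suc n)) (g n) (g (ℕ.suc n)) ⟩
    c * (f (ℕ.suc n) - g (ℕ.suc n)) - (f n - g n)
      ∎
    where
    open ≡-Reasoning
    linear : ∀ (c x₀ x₁ y₀ y₁ : ℤ) → (c * x₁ - x₀) - (c * y₁ - y₀) ≡ c * (x₁ - y₁) - (x₀ - y₀)
    linear = solve-∀

  rec-scale : ∀ {f} a → Rec f → Rec (λ n → a * f n)
  rec-scale {f} a rf n = trans (cong (a *_) (rf n)) (linear a c (f n) (f (ℕ.suc n)))
    where
    linear : ∀ (a c x₀ x₁ : ℤ) → a * (c * x₁ - x₀) ≡ c * (a * x₁) - a * x₀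
    linear = solve-∀

module Lucas (c : ℤ) (u : ℕ → ℤ) (u-rec : Recurrence.Rec c u)
             (u₀ : u 0 ≡ + 0) (u₁ : u 1 ≡ + 1) where
  open Recurrence c

  -- Addition formula; the factor c·u m − u (m+1) is "u (m−1)".
  u-add : ∀ m n → u (n ℕ.+ m) ≡ u m * u (ℕ.suc n) - (c * u m - u (ℕ.suc m)) * u n
  u-add m = unique (rec-shift m u-rec)
                   (rec-sub (rec-scale (u m) (rec-suc u-rec)) (rec-scale (c * u m - u (ℕ.suc m)) u-rec))
                   base₀ base₁
    where
    at₀ : ∀ (x p : ℤ) → x ≡ x * + 1 - p * + 0
    at₀ = solve-∀
    at₁ : ∀ (c x y : ℤ) → y ≡ x * (c * + 1 - + 0) - (c * x - y) * + 1
    at₁ = solve-∀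
    base₀ : u m ≡ u m * u 1 - (c * u m - u (ℕ.suc m)) * u 0
    base₀ rewrite u₀ | u₁ = at₀ (u m) (c * u m - u (ℕ.suc m))
    base₁ : u (ℕ.suc m) ≡ u m * u 2 - (c * u m - u (ℕ.suc m)) * u 1
    base₁ rewrite u-rec 0 | u₀ | u₁ = at₁ c (u m) (u (ℕ.suc m))

  cassini : ∀ n → u (ℕ.suc n) * u (ℕ.suc n) - c * u n * u (ℕ.suc n) + u n * u n ≡ + 1
  cassini ℕ.zero rewrite u₀ | u₁ = at₀ c
    where
    at₀ : ∀ (c : ℤ) → + 1 * + 1 - c * + 0 * + 1 + + 0 * + 0 ≡ + 1
    at₀ = solve-∀
  cassini (ℕ.suc n) = begin
    z * z - c * y * z + y * y
      ≡⟨ cong (λ w → w * w - c * y * w + y * y) (u-rec n) ⟩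
    (c * y - x) * (c * y - x) - c * y * (c * y - x) + y * y
      ≡⟨ form-invariant c x y ⟩
    y * y - c * x * y + x * x
      ≡⟨ cassini n ⟩
    + 1 ∎
    where
    open ≡-Reasoning
    x y z : ℤ
    x = u n
    y = u (ℕ.suc n)
    z = u (ℕ.suc (ℕ.suc n))
    form-invariant : ∀ (c x y : ℤ) →
      (c * y - x) * (c * y - x) - c * y * (c * y - x) + y * y ≡ y * y - c * x * y + x * x
    form-invariant = solve-∀

  -- The companion sequence V n = u (n+1) − u (n−1).
  V : ℕ → ℤ
  V n = + 2 * u (ℕ.suc n) - c * u n

  V-rec : Rec V
  V-rec = rec-sub (rec-scale (+ 2) (rec-suc u-rec)) (rec-scale c u-rec)

  -- Both sides solve the
  -- recurrence in j; they agree at j = 0 by the addition formula and at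
  -- j = 1 by the addition formula together with Cassini's identity.
  u-diff : ∀ s j → u (j ℕ.+ (s ℕ.+ s)) - u j ≡ u s * V (j ℕ.+ s)
  u-diff s = unique (rec-sub (rec-shift (s ℕ.+ s) u-rec) u-rec)
                    (rec-scale (u s) (rec-shift s V-rec))
                    base₀ base₁
    where
    open ≡-Reasoning
    x y : ℤ
    x = u s
    y = u (ℕ.suc s)
    at₀ : ∀ (c x y : ℤ) → (x * y - (c * x - y) * x) - + 0 ≡ x * (+ 2 * y - c * x)
    at₀ = solve-∀
    at₁ : ∀ (c x y : ℤ) →
      (x * (c * y - x) - (c * x - y) * y) - (y * y - c * x * y + x * x)
        ≡ x * (+ 2 * (c * y - x) - c * y)
    at₁ = solve-∀
    base₀ : u (s ℕ.+ s) - u 0 ≡ x * V s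
    base₀ = trans (cong₂ _-_ (u-add s s) u₀) (at₀ c x y)
    base₁ : u (ℕ.suc (s ℕ.+ s)) - u 1 ≡ x * V (ℕ.suc s)
    base₁ = begin
      u (ℕ.suc (s ℕ.+ s)) - u 1
        ≡⟨ cong₂ _-_ (u-add s (ℕ.suc s)) (trans u₁ (sym (cassini s))) ⟩
      (x * u (ℕ.suc (ℕ.suc s)) - (c * x - y) * y) - (y * y - c * x * y + x * x)
        ≡⟨ cong (λ w → (x * w - (c * x - y) * y) - (y * y - c * x * y + x * x)) (u-rec s) ⟩
      (x * (c * y - x) - (c * x - y) * y) - (y * y - c * x * y + x * x)
        ≡⟨ at₁ c x y ⟩
      x * (+ 2 * (c * y - x) - c * y)
        ≡⟨ cong (λ w → x * (+ 2 * w - c * y)) (sym (u-rec s)) ⟩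
      x * V (ℕ.suc s) ∎

module TwoAdic (k : ℕ) where
  open Lucas (+ 4 * + k + + 2) (U k) (λ n → refl) refl refl

  -- u n ≡ n (mod 2): c is even, so u (n+2) ≡ −u n ≡ u n (mod 2).
  U-parity : ∀ n → + 2 ∣ U k n - + n
  U-parity ℕ.zero = divides (+ 0) refl
  U-parity (ℕ.suc ℕ.zero) = divides (+ 0) refl
  U-parity (ℕ.suc (ℕ.suc n)) =
    subst (+ 2 ∣_) (sym (split (+ k) (U k n) (U k (ℕ.suc n)) (+ n)))
      (∣m∣n⇒∣m+n (∣m⇒∣m*n ((+ 2 * + k + + 1) * U k (ℕ.suc n) - U k n - + 1) ∣-refl)
                 (U-parity n))
    where
    split : ∀ (k x y n : ℤ) →
      (+ 4 * k + + 2) * y - x - (+ 2 + n) ≡ + 2 * ((+ 2 * k + + 1) * y - x - + 1) + (x - n)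
    split = solve-∀

  W : ℕ → ℤ
  W n = U k (ℕ.suc n) - (+ 2 * + k + + 1) * U k n

  V≡2W : ∀ n → V n ≡ + 2 * W n
  V≡2W n = halving (+ k) (U k n) (U k (ℕ.suc n))
    where
    halving : ∀ (k x y : ℤ) → + 2 * y - (+ 4 * k + + 2) * x ≡ + 2 * (y - (+ 2 * k + + 1) * x)
    halving = solve-∀

  -- W n is odd, since W n ≡ (n+1) − (2k+1)·n ≡ 1 (mod 2).
  W-odd : ∀ n → + 2 ∣ W n - + 1
  W-odd n =
    subst (+ 2 ∣_) (sym (split (+ k) (U k n) (U k (ℕ.suc n)) (+ n)))
      (∣m∣n⇒∣m-n (∣m∣n⇒∣m-n (U-parity (ℕ.suc n)) (∣n⇒∣m*n (+ 2 * + k + + 1) (U-parity n)))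
                 (∣m⇒∣m*n (+ k * + n) ∣-refl))
    where
    split : ∀ (k x y n : ℤ) →
      (y - (+ 2 * k + + 1) * x) - + 1 ≡ (y - (+ 1 + n)) - (+ 2 * k + + 1) * (x - n) - + 2 * (k * n)
    split = solve-∀

  gap-even : ∀ j d → + 2 ∣ U k (j ℕ.+ d) - U k j → + 2 ∣ + d
  gap-even j d h =
    subst (+ 2 ∣_) (split (U k (j ℕ.+ d)) (U k j) (+ j) (+ d))
      (∣m∣n⇒∣m-n h (∣m∣n⇒∣m-n (U-parity (j ℕ.+ d)) (U-parity j)))
    where
    split : ∀ (x y j d : ℤ) → (x - y) - ((x - (j + d)) - (y - j)) ≡ d
    split = solve-∀

  -- Halving an even gap: by the key identity u (j+2s) − u j = 2·u s·W (j+s),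
  -- and W (j+s) is odd, so 2^(a+1) ∣ u (j+2s) − u j gives 2^a ∣ u s.
  halve-gap : ∀ a j s → + (2 ^ ℕ.suc a) ∣ U k (j ℕ.+ (s ℕ.+ s)) - U k j → + (2 ^ a) ∣ U k s
  halve-gap a j s h = cancel-odd a (W-odd (j ℕ.+ s)) (halve a (subst (+ (2 ^ ℕ.suc a) ∣_) diff≡2uW h))
    where
    regroup : ∀ (x w : ℤ) → x * (+ 2 * w) ≡ + 2 * (x * w)
    regroup = solve-∀
    diff≡2uW : U k (j ℕ.+ (s ℕ.+ s)) - U k j ≡ + 2 * (U k s * W (j ℕ.+ s))
    diff≡2uW = trans (u-diff s j) (trans (cong (U k s *_) (V≡2W (j ℕ.+ s)))
                                         (regroup (U k s) (W (j ℕ.+ s))))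

  -- Main lemma: 2^a ∣ u (j+d) − u j implies 2^a ∣ d.  For a+1 the gap d = 2s
  -- is even, halve-gap gives 2^a ∣ u s = u (0+s) − u 0, and the induction
  -- hypothesis gives 2^a ∣ s.
  gap-divisible : ∀ a j d → + (2 ^ a) ∣ U k (j ℕ.+ d) - U k j → + (2 ^ a) ∣ + d
  gap-divisible ℕ.zero j d _ = divides (+ d) (sym (ℤₚ.*-identityʳ (+ d)))
  gap-divisible (ℕ.suc a) j d h =
    let s , d≡s+s = even⇒double (gap-even j d (∣-trans (two∣pow2-suc a) h))
        h′ = subst (λ e → + (2 ^ ℕ.suc a) ∣ U k (j ℕ.+ e) - U k j) d≡s+s h
        2^a∣us = subst (+ (2 ^ a) ∣_) (sym (ℤₚ.+-identityʳ (U k s))) (halve-gap a j s h′)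
    in subst (λ e → + (2 ^ ℕ.suc a) ∣ + e) (sym d≡s+s)
         (subst (+ (2 ^ ℕ.suc a) ∣_) (twice (+ s)) (double a (gap-divisible a 0 s 2^a∣us)))
    where
    twice : ∀ (x : ℤ) → + 2 * x ≡ x + x
    twice = solve-∀

  ordered : ∀ a {i j} → j ℕ.≤ i → + (2 ^ a) ∣ U k i - U k j → + (2 ^ a) ∣ + i - + j
  ordered a {i} {j} j≤i h =
    let d , j+d≡i = ℕₚ.m≤n⇒∃[o]m+o≡n j≤i
        h′ = subst (λ e → + (2 ^ a) ∣ U k e - U k j) (sym j+d≡i) h
    in subst (λ e → + (2 ^ a) ∣ + e - + j) j+d≡i
         (subst (+ (2 ^ a) ∣_) (sym (forward (+ j) (+ d))) (gap-divisible a j d h′))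
    where
    forward : ∀ (x y : ℤ) → x + y - x ≡ y
    forward = solve-∀

  indices : ∀ a i j → + (2 ^ a) ∣ U k i - U k j → + (2 ^ a) ∣ + i - + j
  indices a i j h with ℕₚ.≤-total j i
  ... | inj₁ j≤i = ordered a j≤i h
  ... | inj₂ i≤j = ∣-swap {x = + j} {+ i} (ordered a i≤j (∣-swap {x = U k i} {U k j} h))

lemma1 : (k : ℕ) → k ≥ 1 → (a i j : ℕ) →
    U k i ≡ U k j [mod + (2 ^ a) ] →
    + i ≡ + j [mod + (2 ^ a) ]
lemma1 k _ a i j h = ∣⇒∣ᵤ (TwoAdic.indices k a i j (∣ᵤ⇒∣ h))
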